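{- For integers $k \ge r \ge 2$ and $1 \le i \le k-r+1$, $\beta_i(k,r) \le (i+1)(r-1)$.
   Context: A $k$-partite graph comes with a fixed partition of its vertex set into $k$ parts (parts may be empty). For $k \ge r \ge 2$ and $1 \le i \le k-r+1$, $\beta_i(k,r)$ is the minimum number of vertices of a $K_r$-free $k$-partite graph such that, for every choice of $k-i$ of its parts, the subgraph induced by those parts contains a $K_{r-1}$. -}

module Defs where

open import Data.Nat using (ℕ; _≤_; _∸_)
open import Data.Fin using (Fin)
open import Data.Fin.Subset using (Subset; _∈_; ∣_∣)
open import Data.Product using (Σ; _×_; ∃)
open import Relation.Binary.PropositionalEquality using (_≡_; _≢_)
open import Relation.Nullary using (¬_)
open import Function.Definitions using (Injective)

-- A (finite simple) k-partite graph: vertex set Fin n, a fixed assignment of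
-- each vertex to one of k parts (parts may be empty), and a symmetric,
-- irreflexive adjacency relation with no edge inside a part.
record KPartiteGraph (k : ℕ) : Set₁ where
  field
    n     : ℕ
    part  : Fin n → Fin k
    Adj   : Fin n → Fin n → Set
    sym   : ∀ {u v} → Adj u v → Adj v u
    irrefl : ∀ {v} → ¬ Adj v v
    partite : ∀ {u v} → Adj u v → part u ≢ part v

open KPartiteGraph public

IsClique : ∀ {k} (G : KPartiteGraph k) (m : ℕ) → (Fin m → Fin (n G)) → Set
IsClique G m f = Injective _≡_ _≡_ f × (∀ a b → a ≢ b → Adj G (f a) (f b))

KrFree : ∀ {k} → KPartiteGraph k → ℕ → Set
KrFree G r = ¬ Σ (Fin r → Fin (n G)) (IsClique G r)

InducedHasClique : ∀ {k} (G : KPartiteGraph k) (S : Subset k) (m : ℕ) → Set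
InducedHasClique G S m =
  Σ (Fin m → Fin (n G)) λ f → IsClique G m f × (∀ a → part G (f a) ∈ S)

-- G witnesses the defining property of β_i(k,r): K_r-free, and for every
-- choice of k - i parts, the induced subgraph contains a K_{r-1}.
BetaWitness : (i k r : ℕ) → KPartiteGraph k → Set
BetaWitness i k r G =
  KrFree G r × (∀ (S : Subset k) → ∣ S ∣ ≡ k ∸ i → InducedHasClique G S (r ∸ 1))

-- "β_i(k,r) ≤ m": since β_i(k,r) is the minimum number of vertices of such a
-- graph, β_i(k,r) ≤ m holds iff some such graph has at most m vertices.
β≤ : (i k r m : ℕ) → Set₁
β≤ i k r m = Σ (KPartiteGraph k) λ G → BetaWitness i k r G × (n G ≤ m)

-- Write R = r - 1.  Take (i+1)·R vertices (j , c) with row j ≤ i and colour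
-- c < R, and put (j , c) into part c + j.  Two vertices are adjacent when
-- they are ordered the same way by colour and by part (both strictly).
--
--  * Such a "concordance graph" is k-partite, and it is K_{R+1}-free because
--    among R+1 vertices two share a colour (pigeonhole), hence are not adjacent.
--  * If a part-set S has at least R elements and misses at most i parts, list
--    the R smallest elements s_0 < … < s_{R-1} of S; then c ≤ s_c ≤ c + i,
--    so (s_c - c , c) is a vertex lying in part s_c, and these R vertices are
--    increasing in both colour and part, i.e. they form a K_R inside S.
module Submission where

open import Defs
open import Data.Nat as ℕ using (ℕ; zero; suc; z≤n; s≤s; _≤_; _+_; _*_; _∸_)
open import Data.Nat.Properties
open import Data.Fin as Fin using (Fin; toℕ; fromℕ<; combine; remQuot)
open import Data.Fin.Properties
  using (toℕ-fromℕ<; remQuot-combine; pigeonhole; toℕ<n; toℕ-injective)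
  renaming (<-cmp to <-cmpᶠ; <-irrefl to <-irreflᶠ)
open import Data.Fin.Subset using (Subset; inside; outside; ∣_∣; _∈_)
open import Data.Fin.Subset.Properties using (∣p∣≤n)
open import Data.Vec using ([]; _∷_; here; there)
open import Data.Product using (_×_; _,_; proj₁; proj₂)
open import Data.Sum using (_⊎_; inj₁; inj₂)
open import Data.Empty using (⊥-elim)
open import Relation.Binary.Core using (_Preserves_⟶_)
open import Relation.Binary.Definitions using (tri<; tri≈; tri>)
open import Relation.Binary.PropositionalEquality
  using (_≡_; _≢_; refl; cong; subst; subst₂; module ≡-Reasoning)
  renaming (sym to ≡-sym; trans to ≡-trans)

Increasing : ∀ {m n} → (Fin m → Fin n) → Set
Increasing f = f Preserves Fin._<_ ⟶ Fin._<_

-- The c-th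
-- of them is at least c, and at most c plus the number of elements missing
-- from S (each element below it is either one of the previous picks or
-- missing from S).
record Selection {k : ℕ} (S : Subset k) (m : ℕ) : Set where
  field
    pick       : Fin m → Fin k
    pick-∈     : ∀ c → pick c ∈ S
    pick-≥     : ∀ c → toℕ c ≤ toℕ (pick c)
    pick-≤     : ∀ c → toℕ (pick c) ≤ toℕ c + (k ∸ ∣ S ∣)
    increasing : Increasing pick

select : ∀ {k} (S : Subset k) {m} → m ≤ ∣ S ∣ → Selection S m
select [] {zero} _ = record
  { pick = λ () ; pick-∈ = λ () ; pick-≥ = λ () ; pick-≤ = λ () ; increasing = λ {} }
select (outside ∷ S) m≤∣S∣ = record
  { pick       = λ c → Fin.suc (pick c)
  ; pick-∈     = λ c → there (pick-∈ c)
  ; pick-≥     = λ c → m≤n⇒m≤1+n (pick-≥ c)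
  ; pick-≤     = λ c → ≤-trans (s≤s (pick-≤ c)) (≤-reflexive (one-more-missing c))
  ; increasing = λ c<d → s≤s (increasing c<d)
  }
  where
    open Selection (select S m≤∣S∣)
    one-more-missing : ∀ c → suc (toℕ c + (_ ∸ ∣ S ∣)) ≡ toℕ c + (suc _ ∸ ∣ S ∣)
    one-more-missing c = begin
      suc (toℕ c + (_ ∸ ∣ S ∣))  ≡⟨ +-suc (toℕ c) _ ⟨
      toℕ c + suc (_ ∸ ∣ S ∣)    ≡⟨ cong (toℕ c +_) (+-∸-assoc 1 (∣p∣≤n S)) ⟨
      toℕ c + (suc _ ∸ ∣ S ∣)    ∎
      where open ≡-Reasoning
select (inside ∷ S) {zero} _ = record
  { pick = λ () ; pick-∈ = λ () ; pick-≥ = λ () ; pick-≤ = λ () ; increasing = λ {} }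
select (inside ∷ S) {suc m} (s≤s m≤∣S∣) = record
  { pick = pick′ ; pick-∈ = pick′-∈ ; pick-≥ = pick′-≥ ; pick-≤ = pick′-≤ ; increasing = pick′-< }
  where
    open Selection (select S m≤∣S∣)
    pick′ : Fin (suc m) → Fin (suc _)
    pick′ Fin.zero    = Fin.zero
    pick′ (Fin.suc c) = Fin.suc (pick c)
    pick′-∈ : ∀ c → pick′ c ∈ (inside ∷ S)
    pick′-∈ Fin.zero    = here
    pick′-∈ (Fin.suc c) = there (pick-∈ c)
    pick′-≥ : ∀ c → toℕ c ≤ toℕ (pick′ c)
    pick′-≥ Fin.zero    = z≤n
    pick′-≥ (Fin.suc c) = s≤s (pick-≥ c)
    pick′-≤ : ∀ c → toℕ (pick′ c) ≤ toℕ c + (suc _ ∸ ∣ inside ∷ S ∣)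
    pick′-≤ Fin.zero    = z≤n
    pick′-≤ (Fin.suc c) = s≤s (pick-≤ c)
    pick′-< : Increasing pick′
    pick′-< {Fin.zero}  {Fin.suc _} _         = s≤s z≤n
    pick′-< {Fin.suc _} {Fin.suc _} (s≤s c<d) = s≤s (increasing c<d)

module Concordance {n R k : ℕ} (colour : Fin n → Fin R) (partOf : Fin n → Fin k) where

  Concordant : Fin n → Fin n → Set
  Concordant u v = (colour u Fin.< colour v × partOf u Fin.< partOf v)
                 ⊎ (colour v Fin.< colour u × partOf v Fin.< partOf u)

  graph : KPartiteGraph k
  graph = record
    { n       = n
    ; part    = partOf
    ; Adj     = Concordant
    ; sym     = λ { (inj₁ x) → inj₂ x ; (inj₂ x) → inj₁ x }
    ; irrefl  = λ { (inj₁ (c<c , _)) → <-irreflᶠ refl c<c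
                  ; (inj₂ (c<c , _)) → <-irreflᶠ refl c<c }
    ; partite = λ { (inj₁ (_ , p<q)) p≡q → <-irreflᶠ p≡q p<q
                  ; (inj₂ (_ , q<p)) p≡q → <-irreflᶠ (≡-sym p≡q) q<p }
    }

  -- Same-coloured vertices are never adjacent, so by pigeonhole no R+1
  -- vertices are pairwise adjacent.
  cliqueFree : KrFree graph (suc R)
  cliqueFree (f , _ , adjacent) with pigeonhole (n<1+n R) (λ a → colour (f a))
  ... | a , b , a<b , same with adjacent a b (λ a≡b → <-irreflᶠ a≡b a<b)
  ... | inj₁ (c<c , _) = <-irreflᶠ same c<c
  ... | inj₂ (c<c , _) = <-irreflᶠ (≡-sym same) c<c

  increasing-clique : ∀ {m} (f : Fin m → Fin n) →
    Increasing (λ a → colour (f a)) → Increasing (λ a → partOf (f a)) → IsClique graph m f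
  increasing-clique f colour-< part-< = injective , adjacent
    where
      adjacent : ∀ a b → a ≢ b → Concordant (f a) (f b)
      adjacent a b a≢b with <-cmpᶠ a b
      ... | tri< a<b _ _ = inj₁ (colour-< a<b , part-< a<b)
      ... | tri≈ _ a≡b _ = ⊥-elim (a≢b a≡b)
      ... | tri> _ _ b<a = inj₂ (colour-< b<a , part-< b<a)
      injective : ∀ {a b} → f a ≡ f b → a ≡ b
      injective {a} {b} fa≡fb with <-cmpᶠ a b
      ... | tri< a<b _ _ = ⊥-elim (<-irreflᶠ (cong colour fa≡fb) (colour-< a<b))
      ... | tri≈ _ a≡b _ = a≡b
      ... | tri> _ _ b<a = ⊥-elim (<-irreflᶠ (cong colour (≡-sym fa≡fb)) (colour-< b<a))

module Staircase (k R i : ℕ) (R+i≤k : R + i ≤ k) where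

  Vertex : Set
  Vertex = Fin ((i + 1) * R)

  row : Vertex → Fin (i + 1)
  row v = proj₁ (remQuot {i + 1} R v)

  colour : Vertex → Fin R
  colour v = proj₂ (remQuot {i + 1} R v)

  part-bound : ∀ v → toℕ (colour v) + toℕ (row v) ℕ.< k
  part-bound v = ≤-trans (+-mono-≤ (toℕ<n (colour v)) (ℕ.s≤s⁻¹ row<1+i)) R+i≤k
    where
      row<1+i : toℕ (row v) ℕ.< 1 + i
      row<1+i = subst (toℕ (row v) ℕ.<_) (+-comm i 1) (toℕ<n (row v))

  partOf : Vertex → Fin k
  partOf v = fromℕ< (part-bound v)

  open Concordance colour partOf public

  vertexAt : (c : Fin R) (s : Fin k) → toℕ s ≤ toℕ c + i → Vertex
  vertexAt c s s≤c+i = combine (fromℕ< row<1+i) c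
    where
      row<1+i : toℕ s ∸ toℕ c ℕ.< i + 1
      row<1+i = subst (toℕ s ∸ toℕ c ℕ.<_) (+-comm 1 i) (s≤s (m≤n+o⇒m∸n≤o (toℕ s) (toℕ c) s≤c+i))

  colour-vertexAt : ∀ c s s≤c+i → colour (vertexAt c s s≤c+i) ≡ c
  colour-vertexAt c s s≤c+i = cong proj₂ (remQuot-combine {i + 1} {R} _ c)

  part-vertexAt : ∀ c s → toℕ c ≤ toℕ s → ∀ s≤c+i → partOf (vertexAt c s s≤c+i) ≡ s
  part-vertexAt c s c≤s s≤c+i = toℕ-injective (begin
    toℕ (partOf v)                ≡⟨ toℕ-fromℕ< (part-bound v) ⟩
    toℕ (colour v) + toℕ (row v)  ≡⟨ cong (λ p → toℕ (proj₂ p) + toℕ (proj₁ p)) (remQuot-combine {i + 1} {R} _ c) ⟩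
    toℕ c + toℕ (fromℕ< _)        ≡⟨ cong (toℕ c +_) (toℕ-fromℕ< _) ⟩
    toℕ c + (toℕ s ∸ toℕ c)       ≡⟨ m+[n∸m]≡n c≤s ⟩
    toℕ s                         ∎)
    where
      open ≡-Reasoning
      v = vertexAt c s s≤c+i

  -- A part-set with at least R elements and at most i missing parts contains
  -- a K_R: the vertex of colour c in the c-th part of S, for every c < R.
  clique-in : (S : Subset k) → R ≤ ∣ S ∣ → k ∸ ∣ S ∣ ≤ i → InducedHasClique graph S R
  clique-in S R≤∣S∣ missing≤i =
    f , increasing-clique f colour-< part-< , λ c → subst (_∈ S) (≡-sym (part-f c)) (pick-∈ c)
    where
      open Selection (select S R≤∣S∣)
      pick≤c+i : ∀ c → toℕ (pick c) ≤ toℕ c + i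
      pick≤c+i c = ≤-trans (pick-≤ c) (+-monoʳ-≤ (toℕ c) missing≤i)
      f : Fin R → Vertex
      f c = vertexAt c (pick c) (pick≤c+i c)
      colour-f : ∀ c → colour (f c) ≡ c
      colour-f c = colour-vertexAt c (pick c) (pick≤c+i c)
      part-f : ∀ c → partOf (f c) ≡ pick c
      part-f c = part-vertexAt c (pick c) (pick-≥ c) (pick≤c+i c)
      colour-< : Increasing (λ c → colour (f c))
      colour-< {a} {b} a<b = subst₂ Fin._<_ (≡-sym (colour-f a)) (≡-sym (colour-f b)) a<b
      part-< : Increasing (λ c → partOf (f c))
      part-< {a} {b} a<b = subst₂ Fin._<_ (≡-sym (part-f a)) (≡-sym (part-f b)) (increasing a<b)

staircase-fits : ∀ k R i → suc R ≤ k → i ≤ k ∸ suc R + 1 → R + i ≤ k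
staircase-fits k R i r≤k i≤k-r+1 = begin
  R + i                  ≤⟨ +-monoʳ-≤ R i≤k-r+1 ⟩
  R + (k ∸ suc R + 1)    ≡⟨ cong (R +_) (+-comm (k ∸ suc R) 1) ⟩
  R + suc (k ∸ suc R)    ≡⟨ +-suc R _ ⟩
  suc R + (k ∸ suc R)    ≡⟨ m+[n∸m]≡n r≤k ⟩
  k                      ∎
  where open ≤-Reasoning

corollary3p4 : (k r i : ℕ) → 2 ≤ r → r ≤ k → 1 ≤ i → i ≤ k ∸ r + 1 →
    β≤ i k r ((i + 1) * (r ∸ 1))
corollary3p4 k zero    i () _ _ _
corollary3p4 k (suc R) i _ r≤k _ i≤k-r+1 = graph , (cliqueFree , cliques) , ≤-refl
  where
    R+i≤k : R + i ≤ k
    R+i≤k = staircase-fits k R i r≤k i≤k-r+1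
    open Staircase k R i R+i≤k
    cliques : ∀ S → ∣ S ∣ ≡ k ∸ i → InducedHasClique graph S R
    cliques S ∣S∣≡k-i = clique-in S
      (subst (R ≤_) (≡-sym ∣S∣≡k-i) (m+n≤o⇒m≤o∸n R R+i≤k))
      (≤-reflexive (≡-trans (cong (k ∸_) ∣S∣≡k-i) (m∸[m∸n]≡n (≤-trans (m≤n+m i R) R+i≤k))))
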